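{- Let $\mathrm{sort}$ be a sort function satisfying the characteristic property. For every type $T$, every relation $\leq$ on $T$ and every $s : \mathrm{list}\,T$ that is pairwise sorted w.r.t. $\leq$, we have $\mathrm{sort}_\leq\,s = s$.
   Context: A list $[x_0,\dots,x_n]$ is pairwise sorted w.r.t. a relation $R$ if $x_i \mathrel{R} x_j$ holds for all $i < j \leq n$. Lists: $[]$ is the empty list, $x :: s$ is cons, $[x]$ is the singleton list, $\mathbin{+\!\!+}$ is concatenation. A "relation" $\leq$ on a type $T$ is a function $T \to T \to \mathrm{bool}$. The merge of two lists w.r.t. $\leq$ is defined by $[] \mathbin{\land\hspace{ -.45em}\land}_\leq ys = ys$, $xs \mathbin{\land\hspace{ -.45em}\land}_\leq [] = xs$, and $(x :: xs) \mathbin{\land\hspace{ -.45em}\land}_\leq (y :: ys) = x :: (xs \mathbin{\land\hspace{ -.45em}\land}_\leq (y :: ys))$ if $x \leq y$, and $= y :: ((x :: xs) \mathbin{\land\hspace{ -.45em}\land}_\leq ys)$ otherwise. A sort function $\mathrm{sort}$ assigns to every type $T$ and relation $\leq$ on $T$ a function $\mathrm{sort}_\leq : \mathrm{list}\,T \to \mathrm{list}\,T$. It satisfies the characteristic property if there is a polymorphic function $\mathrm{asort}$ of type $\forall (T\,R : \mathcal{U}), (R \to R \to R) \to (T \to R) \to R \to \mathrm{list}\,T \to R$ such that: (1) for all $T$, $\leq$, $xs$: $\mathrm{asort}\,(\mathbin{\land\hspace{ -.45em}\land}_\leq)\,(\lambda x.[x])\,[]\,xs = \mathrm{sort}_\leq\,xs$;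 (2) for all $T$, $xs$: $\mathrm{asort}\,(\mathbin{+\!\!+})\,(\lambda x.[x])\,[]\,xs = xs$; (3) $\mathrm{asort}$ is relationally parametric: for all types $T_1,T_2$ and relation $\sim_T \subseteq T_1 \times T_2$, all types $R_1,R_2$ and relation $\sim_R \subseteq R_1\times R_2$, all $m_i : R_i \to R_i \to R_i$ with $a_1 \sim_R a_2 \wedge b_1 \sim_R b_2 \Rightarrow m_1\,a_1\,b_1 \sim_R m_2\,a_2\,b_2$, all $s_i : T_i \to R_i$ with $x_1 \sim_T x_2 \Rightarrow s_1\,x_1 \sim_R s_2\,x_2$, all $e_i : R_i$ with $e_1 \sim_R e_2$, and all lists $xs_1 : \mathrm{list}\,T_1$, $xs_2 : \mathrm{list}\,T_2$ of equal length that are pointwise $\sim_T$-related, we have $\mathrm{asort}\,m_1\,s_1\,e_1\,xs_1 \sim_R \mathrm{asort}\,m_2\,s_2\,e_2\,xs_2$. -}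

module Defs where

open import Data.Bool using (Bool; true; false; if_then_else_)
open import Data.List using (List; []; _∷_; [_]; _++_)
open import Data.List.Relation.Binary.Pointwise using (Pointwise)
open import Data.List.Relation.Unary.AllPairs using (AllPairs)
open import Relation.Binary.PropositionalEquality using (_≡_)
open import Data.Product using (Σ; _×_)

BoolRel : Set → Set
BoolRel T = T → T → Bool

PairwiseSorted : {T : Set} → BoolRel T → List T → Set
PairwiseSorted _≤_ = AllPairs (λ x y → (x ≤ y) ≡ true)

-- Merge w.r.t. ≤ (the equations of the paper; inner helper for termination).
merge : {T : Set} → BoolRel T → List T → List T → List T
merge _≤_ [] ys = ys
merge _≤_ (x ∷ xs) ys = go ys
  where
  go : List _ → List _
  go [] = x ∷ xs
  go (y ∷ ys') = if x ≤ y then x ∷ merge _≤_ xs (y ∷ ys') else y ∷ go ys'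

SortFun : Set₁
SortFun = (T : Set) → BoolRel T → List T → List T

ASort : Set₁
ASort = (T R : Set) → (R → R → R) → (T → R) → R → List T → R

Parametric : ASort → Set₁
Parametric asort =
  ∀ (T₁ T₂ : Set) (_∼T_ : T₁ → T₂ → Set)
    (R₁ R₂ : Set) (_∼R_ : R₁ → R₂ → Set)
    (m₁ : R₁ → R₁ → R₁) (m₂ : R₂ → R₂ → R₂) →
    (∀ {a₁ a₂ b₁ b₂} → a₁ ∼R a₂ → b₁ ∼R b₂ → m₁ a₁ b₁ ∼R m₂ a₂ b₂) →
  ∀ (s₁ : T₁ → R₁) (s₂ : T₂ → R₂) →
    (∀ {x₁ x₂} → x₁ ∼T x₂ → s₁ x₁ ∼R s₂ x₂) →
  ∀ (e₁ : R₁) (e₂ : R₂) → e₁ ∼R e₂ →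
  ∀ (xs₁ : List T₁) (xs₂ : List T₂) → Pointwise _∼T_ xs₁ xs₂ →
    asort T₁ R₁ m₁ s₁ e₁ xs₁ ∼R asort T₂ R₂ m₂ s₂ e₂ xs₂

CharacteristicProperty : SortFun → Set₁
CharacteristicProperty sort =
  Σ ASort λ asort →
    ((T : Set) (_≤_ : BoolRel T) (xs : List T) →
       asort T (List T) (merge _≤_) [_] [] xs ≡ sort T _≤_ xs)
    × ((T : Set) (xs : List T) → asort T (List T) _++_ [_] [] xs ≡ xs)
    × Parametric asort

-- Parametricity forces asort m s e xs to be the evaluation, in the algebra (m, s, e), of one
-- fixed binary tree over xs (the result of asort in the free algebra). Evaluated with _++_ that
-- tree gives back xs; so when xs is sorted, at every node the left leaves are ≤ the right leaves,
-- where merge acts as _++_, and evaluating the tree with merge also gives back xs.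
module Submission where

open import Defs
open import Data.Bool using (true)
open import Data.List using (List; []; _∷_; [_]; _++_)
open import Data.List.Properties using (++-identityʳ)
open import Data.List.Relation.Unary.All using (All; []; _∷_)
import Data.List.Relation.Unary.All.Properties as All
open import Data.List.Relation.Unary.AllPairs using (AllPairs; []; _∷_)
import Data.List.Relation.Binary.Pointwise.Properties as Pointwise
open import Data.Product using (_×_; _,_)
open import Relation.Binary.PropositionalEquality
  using (_≡_; refl; sym; trans; cong; cong₂; subst; module ≡-Reasoning)

data Tree (T : Set) : Set where
  leaf  : T → Tree T
  node  : Tree T → Tree T → Tree T
  empty : Tree T

eval : {T R : Set} → (R → R → R) → (T → R) → R → Tree T → R
eval m s e (leaf x)   = s x
eval m s e (node l r) = m (eval m s e l) (eval m s e r)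
eval m s e empty      = e

asort-≡-eval : {asort : ASort} → Parametric asort →
  (T R : Set) (m : R → R → R) (s : T → R) (e : R) (xs : List T) →
  asort T R m s e xs ≡ eval m s e (asort T (Tree T) node leaf empty xs)
asort-≡-eval par T R m s e xs =
  par T T _≡_ R (Tree T) (λ r t → r ≡ eval m s e t)
      m node (cong₂ m) s leaf (cong s) e empty refl
      xs xs (Pointwise.refl refl)

Across : {T : Set} → (T → T → Set) → List T → List T → Set
Across R xs ys = All (λ x → All (R x) ys) xs

AllPairs-++⁻ : {T : Set} {R : T → T → Set} (xs : List T) {ys : List T} →
  AllPairs R (xs ++ ys) → AllPairs R xs × AllPairs R ys × Across R xs ys
AllPairs-++⁻ []       p         = [] , p , []
AllPairs-++⁻ (x ∷ xs) (px ∷ p) with AllPairs-++⁻ xs p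
... | pxs , pys , across = All.++⁻ˡ xs px ∷ pxs , pys , All.++⁻ʳ xs px ∷ across

module _ {T : Set} (_≤_ : BoolRel T) where

  merge-across≡++ : (xs ys : List T) → Across (λ x y → (x ≤ y) ≡ true) xs ys →
    merge _≤_ xs ys ≡ xs ++ ys
  merge-across≡++ []       ys       _ = refl
  merge-across≡++ (x ∷ xs) []       _ = cong (x ∷_) (sym (++-identityʳ xs))
  merge-across≡++ (x ∷ xs) (y ∷ ys) ((x≤y ∷ _) ∷ across) rewrite x≤y =
    cong (x ∷_) (merge-across≡++ xs (y ∷ ys) across)

  eval-merge≡eval-++ : (t : Tree T) → PairwiseSorted _≤_ (eval _++_ [_] [] t) →
    eval (merge _≤_) [_] [] t ≡ eval _++_ [_] [] t
  eval-merge≡eval-++ (leaf x)   _      = refl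
  eval-merge≡eval-++ empty      _      = refl
  eval-merge≡eval-++ (node l r) sorted with AllPairs-++⁻ (eval _++_ [_] [] l) sorted
  ... | sorted-l , sorted-r , across = begin
    merge _≤_ (eval (merge _≤_) [_] [] l) (eval (merge _≤_) [_] [] r)
      ≡⟨ cong₂ (merge _≤_) (eval-merge≡eval-++ l sorted-l) (eval-merge≡eval-++ r sorted-r) ⟩
    merge _≤_ (eval _++_ [_] [] l) (eval _++_ [_] [] r)
      ≡⟨ merge-across≡++ (eval _++_ [_] [] l) (eval _++_ [_] [] r) across ⟩
    eval _++_ [_] [] l ++ eval _++_ [_] [] r ∎
    where open ≡-Reasoning

lemma3p10 : (sort : SortFun) → CharacteristicProperty sort →
    (T : Set) (_≤_ : BoolRel T) (s : List T) → PairwiseSorted _≤_ s →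
    sort T _≤_ s ≡ s
lemma3p10 sort (asort , asort-merge , asort-++ , par) T _≤_ s sorted = begin
  sort T _≤_ s
    ≡⟨ sym (asort-merge T _≤_ s) ⟩
  asort T (List T) (merge _≤_) [_] [] s
    ≡⟨ asort-≡-eval par T (List T) (merge _≤_) [_] [] s ⟩
  eval (merge _≤_) [_] [] t
    ≡⟨ eval-merge≡eval-++ _≤_ t (subst (PairwiseSorted _≤_) s≡eval-++ sorted) ⟩
  eval _++_ [_] [] t
    ≡⟨ sym s≡eval-++ ⟩
  s ∎
  where
  open ≡-Reasoning
  t : Tree T
  t = asort T (Tree T) node leaf empty s
  s≡eval-++ : s ≡ eval _++_ [_] [] t
  s≡eval-++ = trans (sym (asort-++ T s)) (asort-≡-eval par T (List T) _++_ [_] [] s)
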